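{- Let $m$ be a positive integer, $r$ a nonnegative integer, $\lambda\in\mathbb{R}$. For $n,k\in\mathbb{N}$ with $n\ge k$, $$W_{m,\lambda}^{(r)}(n+1,k)=W_{m,\lambda}^{(r)}(n,k-1)+(mk+r-n\lambda)W_{m,\lambda}^{(r)}(n,k).$$
   Context: $(x)_{0,\lambda}=1$, $(x)_{n,\lambda}=x(x-\lambda)\cdots(x-(n-1)\lambda)$, $(x)_n=(x)_{n,1}$. The degenerate $r$-Whitney numbers of the second kind are defined by the polynomial identities $(mx+r)_{n,\lambda}=\sum_{k=0}^n W_{m,\lambda}^{(r)}(n,k)m^k(x)_k$, $n\ge0$, with the convention $W_{m,\lambda}^{(r)}(n,k)=0$ if $k<0$ or $k>n$. -}

module Defs where

open import Level using (Level)
open import Data.Nat using (ℕ; zero; suc)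
open import Data.Integer using (ℤ; +_; _<_; _>_)
open import Data.Product using (_×_)
open import Data.Sum using (_⊎_)
open import Relation.Nullary using (¬_)
open import Algebra.Bundles using (CommutativeRing)

module _ {c ℓ : Level} (R : CommutativeRing c ℓ) where
  open CommutativeRing R hiding (zero)

  ι : ℕ → Carrier
  ι zero    = 0#
  ι (suc n) = 1# + ι n

  pow : Carrier → ℕ → Carrier
  pow a zero    = 1#
  pow a (suc n) = pow a n * a

  dff : Carrier → Carrier → ℕ → Carrier
  dff x lam zero    = 1#
  dff x lam (suc n) = dff x lam n * (x - ι n * lam)

  ff : Carrier → ℕ → Carrier
  ff x n = dff x 1# n

  sumTo : ℕ → (ℕ → Carrier) → Carrier
  sumTo zero    f = f zero
  sumTo (suc n) f = sumTo n f + f (suc n)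

  -- R is an integral domain of characteristic zero (as ℝ is)
  record CharZeroDomain : Set (c Level.⊔ ℓ) where
    field
      nonzero-ι  : ∀ n → ¬ (ι (suc n) ≈ 0#)
      no-zero-div : ∀ a b → a * b ≈ 0# → a ≈ 0# ⊎ b ≈ 0#

  -- W : ℕ → ℤ → R is the family of degenerate r-Whitney numbers of the
  -- second kind W^{(r)}_{m,λ}(n,k): it vanishes for k < 0 or k > n, and
  -- (mx+r)_{n,λ} = Σ_{k=0}^n W(n,k) m^k (x)_k for all n and all x in R.
  IsDegWhitney2 : ℕ → ℕ → Carrier → (ℕ → ℤ → Carrier) → Set (c Level.⊔ ℓ)
  IsDegWhitney2 m r lam W =
    (∀ n k → (k < + 0 ⊎ k > + n) → W n k ≈ 0#) ×
    (∀ n x → dff (ι m * x + ι r) lam n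
               ≈ sumTo n (λ k → W n (+ k) * pow (ι m) k * ff x k))
    where
      open import Data.Product using () renaming (_×_ to _×_)

-- The recurrence is read off by comparing two expansions of (mx+r)_{n+1,λ}
-- in the falling-factorial basis. Expanding (mx+r)_{n,λ} and multiplying by
-- the last factor mx + r − nλ = m(x − k) + (mk + r − nλ) turns the k-th term
-- into a multiple of (x)_{k+1} plus a multiple of (x)_k. The falling
-- factorials are linearly independent as functions over a domain of
-- characteristic zero: evaluating at x = j kills (x)_k for k > j and not
-- (x)_j, so the coefficients can be compared one at a time.
module Submission where

open import Defs
open import Level using (Level)
open import Data.Nat using (ℕ; suc; _≤_)
open import Data.Integer using (ℤ) renaming (+_ to ⁺_; _-_ to _-ℤ_)
open import Algebra.Bundles using (CommutativeRing)

import Data.Nat as ℕ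
import Data.Nat.Properties as ℕₚ
import Data.Integer as ℤ
open import Data.Nat.Induction using (<-rec)
open import Data.Maybe using (nothing)
open import Data.Sum using (inj₁; inj₂; [_,_])
open import Data.Product using (_,_; proj₁; proj₂)
open import Data.Empty using (⊥-elim)
open import Relation.Nullary using (¬_)
open import Relation.Binary.PropositionalEquality as ≡ using (_≡_)
open import Relation.Binary.Definitions using (tri<; tri≈; tri>)

module RingLemmas {c ℓ : Level} (R : CommutativeRing c ℓ) where
  open CommutativeRing R hiding (zero)
  open import Relation.Binary.Reasoning.Setoid setoid
  open import Algebra.Solver.Ring.NaturalCoefficients commutativeSemiring (λ _ _ → nothing)
  open import Algebra.Properties.AbelianGroup +-abelianGroup using (⁻¹-∙-comm)
  open import Algebra.Properties.CommutativeSemigroup +-commutativeSemigroup using (interchange)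

  ι-+ : ∀ a b → ι R (a ℕ.+ b) ≈ ι R a + ι R b
  ι-+ ℕ.zero  b = sym (+-identityˡ _)
  ι-+ (suc a) b = trans (+-congˡ (ι-+ a b)) (sym (+-assoc _ _ _))

  affine-rebase : ∀ M x r k a → (M * x + r) - a ≈ M * (x - k * 1#) + ((M * k + r) - a)
  affine-rebase M x r k a = begin
    (M * x + r) - a                          ≈⟨ sym (+-identityʳ _) ⟩
    (M * x + r) - a + 0#                     ≈⟨ +-congˡ (sym (trans (*-congˡ (-‿inverseʳ _)) (zeroʳ M))) ⟩
    (M * x + r) - a + M * (k * 1# - k * 1#)  ≈⟨ rearrange M x r k (- a) (- (k * 1#)) ⟩
    M * (x - k * 1#) + ((M * k + r) - a)     ∎
    where
    -- the semiring solver has no negation, so negated terms enter as atoms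
    rearrange : ∀ M x r k a b → (M * x + r) + a + M * (k * 1# + b) ≈ M * (x + b) + ((M * k + r) + a)
    rearrange = solve 6 (λ M x r k a b →
      (M :* x :+ r) :+ a :+ M :* (k :* con 1 :+ b) := M :* (x :+ b) :+ ((M :* k :+ r) :+ a)) refl

  *-*-distrib-+ : ∀ w p f M d e → w * p * f * (M * d + e) ≈ w * (p * M) * (f * d) + e * w * p * f
  *-*-distrib-+ = solve 6 (λ w p f M d e →
    w :* p :* f :* (M :* d :+ e) := w :* (p :* M) :* (f :* d) :+ e :* w :* p :* f) refl

  +-*-distribʳ : ∀ a b p f → (a + b) * p * f ≈ a * p * f + b * p * f
  +-*-distribʳ = solve 4 (λ a b p f → (a :+ b) :* p :* f := a :* p :* f :+ b :* p :* f) refl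

  ≈0⇒*-*≈0 : ∀ {a} b f → a ≈ 0# → a * b * f ≈ 0#
  ≈0⇒*-*≈0 b f a≈0 = trans (*-congʳ (trans (*-congʳ a≈0) (zeroˡ b))) (zeroˡ f)

  sumTo-cong : ∀ N {f g : ℕ → Carrier} → (∀ k → f k ≈ g k) → sumTo R N f ≈ sumTo R N g
  sumTo-cong ℕ.zero  f≈g = f≈g 0
  sumTo-cong (suc N) f≈g = +-cong (sumTo-cong N f≈g) (f≈g (suc N))

  sumTo-+ : ∀ N (f g : ℕ → Carrier) → sumTo R N (λ k → f k + g k) ≈ sumTo R N f + sumTo R N g
  sumTo-+ ℕ.zero  f g = refl
  sumTo-+ (suc N) f g = trans (+-congʳ (sumTo-+ N f g)) (interchange _ _ _ _)

  sumTo-− : ∀ N (f g : ℕ → Carrier) → sumTo R N (λ k → f k - g k) ≈ sumTo R N f - sumTo R N g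
  sumTo-− ℕ.zero  f g = refl
  sumTo-− (suc N) f g = begin
    sumTo R N (λ k → f k - g k) + (f (suc N) - g (suc N))          ≈⟨ +-congʳ (sumTo-− N f g) ⟩
    (sumTo R N f - sumTo R N g) + (f (suc N) - g (suc N))          ≈⟨ interchange _ _ _ _ ⟩
    (sumTo R N f + f (suc N)) + (- sumTo R N g + - g (suc N))      ≈⟨ +-congˡ (⁻¹-∙-comm _ _) ⟩
    (sumTo R N f + f (suc N)) - (sumTo R N g + g (suc N))          ∎

  sumTo-*ʳ : ∀ N (f : ℕ → Carrier) y → sumTo R N f * y ≈ sumTo R N (λ k → f k * y)
  sumTo-*ʳ ℕ.zero  f y = refl
  sumTo-*ʳ (suc N) f y = trans (distribʳ y _ _) (+-congʳ (sumTo-*ʳ N f y))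

  sumTo-drop-head : ∀ N (f : ℕ → Carrier) → f 0 ≈ 0# → sumTo R (suc N) f ≈ sumTo R N (λ k → f (suc k))
  sumTo-drop-head ℕ.zero  f f0≈0 = trans (+-congʳ f0≈0) (+-identityˡ _)
  sumTo-drop-head (suc N) f f0≈0 = +-congʳ (sumTo-drop-head N f f0≈0)

  sumTo-drop-last : ∀ N (f : ℕ → Carrier) → f (suc N) ≈ 0# → sumTo R (suc N) f ≈ sumTo R N f
  sumTo-drop-last N f fN≈0 = trans (+-congˡ fN≈0) (+-identityʳ _)

  sumTo-zero : ∀ N (f : ℕ → Carrier) → (∀ k → k ≤ N → f k ≈ 0#) → sumTo R N f ≈ 0#
  sumTo-zero ℕ.zero  f f≈0 = f≈0 0 ℕ.z≤n
  sumTo-zero (suc N) f f≈0 = trans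
    (+-cong (sumTo-zero N f (λ k k≤N → f≈0 k (ℕₚ.m≤n⇒m≤1+n k≤N))) (f≈0 (suc N) ℕₚ.≤-refl))
    (+-identityˡ 0#)

  sumTo-single : ∀ N (f : ℕ → Carrier) j → j ≤ N →
                 (∀ k → k ≤ N → ¬ k ≡ j → f k ≈ 0#) → sumTo R N f ≈ f j
  sumTo-single ℕ.zero  f .0 ℕ.z≤n _ = refl
  sumTo-single (suc N) f j j≤1+N f≈0 with ℕₚ.m≤n⇒m<n∨m≡n j≤1+N
  ... | inj₂ ≡.refl = trans
    (+-congʳ (sumTo-zero N f (λ k k≤N → f≈0 k (ℕₚ.m≤n⇒m≤1+n k≤N) (ℕₚ.<⇒≢ (ℕ.s≤s k≤N)))))
    (+-identityˡ _)
  ... | inj₁ j<1+N = trans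
    (+-cong (sumTo-single N f j (ℕₚ.≤-pred j<1+N) (λ k k≤N → f≈0 k (ℕₚ.m≤n⇒m≤1+n k≤N)))
            (f≈0 (suc N) ℕₚ.≤-refl (λ 1+N≡j → ℕₚ.<⇒≢ j<1+N (≡.sym 1+N≡j))))
    (+-identityʳ _)

module FallingFactorialBasis {c ℓ : Level} (R : CommutativeRing c ℓ) (CZ : CharZeroDomain R) where
  open CommutativeRing R hiding (zero)
  open CharZeroDomain CZ
  open RingLemmas R
  open import Relation.Binary.Reasoning.Setoid setoid
  open import Algebra.Properties.Ring ring using ([y-z]x≈yx-zx)
  open import Algebra.Properties.Group +-group using (x∙y⁻¹≈ε⇒x≈y; x≈y⇒x∙y⁻¹≈ε; identityʳ-unique)

  1≉0 : ¬ 1# ≈ 0#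
  1≉0 1≈0 = nonzero-ι 0 (trans (+-identityʳ 1#) 1≈0)

  *-≉0 : ∀ {a b} → ¬ a ≈ 0# → ¬ b ≈ 0# → ¬ a * b ≈ 0#
  *-≉0 a≉0 b≉0 ab≈0 = [ a≉0 , b≉0 ] (no-zero-div _ _ ab≈0)

  *-cancelʳ : ∀ {p a b} → ¬ p ≈ 0# → a * p ≈ b * p → a ≈ b
  *-cancelʳ {p} {a} {b} p≉0 ap≈bp with no-zero-div (a - b) p (trans ([y-z]x≈yx-zx p a b) (x≈y⇒x∙y⁻¹≈ε ap≈bp))
  ... | inj₁ a-b≈0 = x∙y⁻¹≈ε⇒x≈y a b a-b≈0
  ... | inj₂ p≈0   = ⊥-elim (p≉0 p≈0)

  ι≉0 : ∀ {m} → 1 ≤ m → ¬ ι R m ≈ 0#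
  ι≉0 {suc m} _ = nonzero-ι m

  pow-≉0 : ∀ {a} → ¬ a ≈ 0# → ∀ k → ¬ pow R a k ≈ 0#
  pow-≉0 a≉0 ℕ.zero  = 1≉0
  pow-≉0 a≉0 (suc k) = *-≉0 (pow-≉0 a≉0 k) a≉0

  <⇒ι≉ι : ∀ {j k} → k ℕ.< j → ¬ ι R j ≈ ι R k
  <⇒ι≉ι {j} {k} k<j ιj≈ιk with d , 1+k+d≡j ← ℕₚ.m≤n⇒∃[o]m+o≡n k<j =
    nonzero-ι d (identityʳ-unique (ι R k) (ι R (suc d)) (begin
      ι R k + ι R (suc d)  ≈⟨ sym (ι-+ k (suc d)) ⟩
      ι R (k ℕ.+ suc d)    ≡⟨ ≡.cong (ι R) (≡.trans (ℕₚ.+-suc k d) 1+k+d≡j) ⟩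
      ι R j                ≈⟨ ιj≈ιk ⟩
      ι R k                ∎))

  <⇒ff[ι]≈0 : ∀ {j k} → j ℕ.< k → ff R (ι R j) k ≈ 0#
  <⇒ff[ι]≈0 {j} {suc k} j<1+k with ℕₚ.m<1+n⇒m<n∨m≡n j<1+k
  ... | inj₁ j<k    = trans (*-congʳ (<⇒ff[ι]≈0 j<k)) (zeroˡ _)
  ... | inj₂ ≡.refl = trans (*-congˡ (trans (+-congˡ (-‿cong (*-identityʳ _))) (-‿inverseʳ _))) (zeroʳ _)

  ≤⇒ff[ι]≉0 : ∀ {j k} → k ≤ j → ¬ ff R (ι R j) k ≈ 0#
  ≤⇒ff[ι]≉0 {j} {ℕ.zero}  _     = 1≉0
  ≤⇒ff[ι]≉0 {j} {suc k} k<j = *-≉0 (≤⇒ff[ι]≉0 (ℕₚ.<⇒≤ k<j)) λ factor≈0 →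
    <⇒ι≉ι k<j (trans (x∙y⁻¹≈ε⇒x≈y _ _ factor≈0) (*-identityʳ _))

  ff-coefficients-zero : ∀ N (a : ℕ → Carrier) →
                         (∀ x → sumTo R N (λ k → a k * ff R x k) ≈ 0#) → ∀ j → j ≤ N → a j ≈ 0#
  ff-coefficients-zero N a Σ≈0 = <-rec (λ j → j ≤ N → a j ≈ 0#) step
    where
    step : ∀ j → (∀ {i} → i ℕ.< j → i ≤ N → a i ≈ 0#) → j ≤ N → a j ≈ 0#
    step j a<j≈0 j≤N = *-cancelʳ (≤⇒ff[ι]≉0 {j} ℕₚ.≤-refl) (begin
      a j * ff R (ι R j) j                           ≈⟨ sumTo-single N _ j j≤N other-terms≈0 ⟨
      sumTo R N (λ k → a k * ff R (ι R j) k)         ≈⟨ Σ≈0 (ι R j) ⟩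
      0#                                             ≈⟨ zeroˡ _ ⟨
      0# * ff R (ι R j) j                            ∎)
      where
      other-terms≈0 : ∀ k → k ≤ N → ¬ k ≡ j → a k * ff R (ι R j) k ≈ 0#
      other-terms≈0 k k≤N k≢j with ℕₚ.<-cmp k j
      ... | tri< k<j _ _ = trans (*-congʳ (a<j≈0 k<j k≤N)) (zeroˡ _)
      ... | tri≈ _ k≡j _ = ⊥-elim (k≢j k≡j)
      ... | tri> _ _ j<k = trans (*-congˡ (<⇒ff[ι]≈0 j<k)) (zeroʳ _)

  ff-coefficients-unique : ∀ N (a b : ℕ → Carrier) →
    (∀ x → sumTo R N (λ k → a k * ff R x k) ≈ sumTo R N (λ k → b k * ff R x k)) →
    ∀ j → j ≤ N → a j ≈ b j
  ff-coefficients-unique N a b Σa≈Σb j j≤N =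
    x∙y⁻¹≈ε⇒x≈y _ _ (ff-coefficients-zero N (λ k → a k - b k) Σ[a-b]≈0 j j≤N)
    where
    Σ[a-b]≈0 : ∀ x → sumTo R N (λ k → (a k - b k) * ff R x k) ≈ 0#
    Σ[a-b]≈0 x = begin
      sumTo R N (λ k → (a k - b k) * ff R x k)                               ≈⟨ sumTo-cong N (λ k → [y-z]x≈yx-zx _ _ _) ⟩
      sumTo R N (λ k → a k * ff R x k - b k * ff R x k)                      ≈⟨ sumTo-− N _ _ ⟩
      sumTo R N (λ k → a k * ff R x k) - sumTo R N (λ k → b k * ff R x k)    ≈⟨ x≈y⇒x∙y⁻¹≈ε (Σa≈Σb x) ⟩
      0#                                                                     ∎

module WhitneyRecurrence {c ℓ : Level} (R : CommutativeRing c ℓ) (CZ : CharZeroDomain R) where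
  open CommutativeRing R hiding (zero)
  open RingLemmas R
  open FallingFactorialBasis R CZ
  open import Relation.Binary.Reasoning.Setoid setoid

  module _ (m : ℕ) (1≤m : 1 ≤ m) (r : ℕ) (lam : Carrier)
           (W : ℕ → ℤ → Carrier) (isW : IsDegWhitney2 R m r lam W) (n : ℕ) where

    M : Carrier
    M = ι R m

    weight : ℕ → Carrier
    weight k = (M * ι R k + ι R r) - ι R n * lam

    next : ℕ → Carrier
    next k = W n (⁺ k -ℤ ⁺ 1) + weight k * W n (⁺ k)

    expansion : ∀ N x → dff R (M * x + ι R r) lam N ≈ sumTo R N (λ k → W N (⁺ k) * pow R M k * ff R x k)
    expansion = proj₂ isW

    W-below : W n (⁺ 0 -ℤ ⁺ 1) ≈ 0#
    W-below = proj₁ isW n _ (inj₁ ℤ.-<+)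

    W-above : W n (⁺ suc n) ≈ 0#
    W-above = proj₁ isW n _ (inj₂ (ℤ.+<+ (ℕₚ.n<1+n n)))

    term-step : ∀ x k →
      W n (⁺ k) * pow R M k * ff R x k * ((M * x + ι R r) - ι R n * lam) ≈
      W n (⁺ k) * pow R M (suc k) * ff R x (suc k) + weight k * W n (⁺ k) * pow R M k * ff R x k
    term-step x k = trans (*-congˡ (affine-rebase M x (ι R r) (ι R k) (ι R n * lam))) (*-*-distrib-+ _ _ _ _ _ _)

    expansions-agree : ∀ x → sumTo R (suc n) (λ k → W (suc n) (⁺ k) * pow R M k * ff R x k)
                           ≈ sumTo R (suc n) (λ k → next k * pow R M k * ff R x k)
    expansions-agree x = begin
      sumTo R (suc n) (λ k → W (suc n) (⁺ k) * pow R M k * ff R x k)  ≈⟨ expansion (suc n) x ⟨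
      dff R (M * x + ι R r) lam n * last-factor                       ≈⟨ *-congʳ (expansion n x) ⟩
      sumTo R n (λ k → W n (⁺ k) * pow R M k * ff R x k) * last-factor ≈⟨ sumTo-*ʳ n _ _ ⟩
      sumTo R n (λ k → W n (⁺ k) * pow R M k * ff R x k * last-factor) ≈⟨ sumTo-cong n (term-step x) ⟩
      sumTo R n (λ k → raised k + kept k)                             ≈⟨ sumTo-+ n raised kept ⟩
      sumTo R n raised + sumTo R n kept                               ≈⟨ +-cong Σ[1+n]lowered≈Σ[n]raised Σ[1+n]kept≈Σ[n]kept ⟨
      sumTo R (suc n) lowered + sumTo R (suc n) kept                  ≈⟨ sumTo-+ (suc n) lowered kept ⟨
      sumTo R (suc n) (λ k → lowered k + kept k)                      ≈⟨ sumTo-cong (suc n) (λ k → +-*-distribʳ _ _ _ _) ⟨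
      sumTo R (suc n) (λ k → next k * pow R M k * ff R x k)           ∎
      where
      last-factor : Carrier
      last-factor = (M * x + ι R r) - ι R n * lam

      raised kept lowered : ℕ → Carrier
      raised k  = W n (⁺ k) * pow R M (suc k) * ff R x (suc k)
      kept k    = weight k * W n (⁺ k) * pow R M k * ff R x k
      lowered k = W n (⁺ k -ℤ ⁺ 1) * pow R M k * ff R x k

      -- lowered (1 + k) and raised k agree definitionally: ⁺ (1 + k) -ℤ ⁺ 1 computes to ⁺ k
      Σ[1+n]lowered≈Σ[n]raised : sumTo R (suc n) lowered ≈ sumTo R n raised
      Σ[1+n]lowered≈Σ[n]raised = sumTo-drop-head n lowered (≈0⇒*-*≈0 _ _ W-below)

      Σ[1+n]kept≈Σ[n]kept : sumTo R (suc n) kept ≈ sumTo R n kept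
      Σ[1+n]kept≈Σ[n]kept = sumTo-drop-last n kept (≈0⇒*-*≈0 _ _ (trans (*-congˡ W-above) (zeroʳ _)))

    recurrence : ∀ k → k ≤ suc n → W (suc n) (⁺ k) ≈ next k
    recurrence k k≤1+n = *-cancelʳ (pow-≉0 (ι≉0 1≤m) k)
      (ff-coefficients-unique (suc n) _ _ expansions-agree k k≤1+n)

theorem7 : {c ℓ : Level} (R : CommutativeRing c ℓ) → CharZeroDomain R →
    let open CommutativeRing R in
    (m : ℕ) → 1 ≤ m → (r : ℕ) → (lam : Carrier) →
    (W : ℕ → ℤ → Carrier) → IsDegWhitney2 R m r lam W →
    (n k : ℕ) → k ≤ n →
    W (suc n) (⁺ k) ≈ W n (⁺ k -ℤ ⁺ 1) + ((ι R m * ι R k + ι R r) - ι R n * lam) * W n (⁺ k)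
theorem7 R CZ m 1≤m r lam W isW n k k≤n =
  WhitneyRecurrence.recurrence R CZ m 1≤m r lam W isW n k (ℕₚ.m≤n⇒m≤1+n k≤n)
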